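{- If $(a,b,c)\in P$ and $(a,b,c)\ne(1,1,2)$, then at least one of $(a,b,c)A_0^{ -1}$ and $(a,b,c)A_1^{ -1}$ is not in $P$.
   Context: Let $A_0=\begin{pmatrix}0&0&1\\1&0&0\\0&1&1\end{pmatrix}$, $A_1=\begin{pmatrix}1&0&1\\0&1&0\\0&0&1\end{pmatrix}$, acting on row vectors from the right, so $(a,b,c)A_0^{ -1}=(c-b,a,b)$ and $(a,b,c)A_1^{ -1}=(a,b,c-a)$. Let $P=\{(x,y,z)\in\mathbb Z^3:0<x\le y<z\}\cup\{(1,1,1)\}$. -}

module Defs where

open import Data.Integer using (ℤ; _+_; _-_; _≤_; _<_; +_)
open import Data.Product using (_×_; _,_)
open import Data.Sum using (_⊎_)
open import Relation.Binary.PropositionalEquality using (_≡_)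

Triple : Set
Triple = ℤ × ℤ × ℤ

actA₀⁻¹ : Triple → Triple
actA₀⁻¹ (a , b , c) = (c - b , a , b)

actA₁⁻¹ : Triple → Triple
actA₁⁻¹ (a , b , c) = (a , b , c - a)

InP : Triple → Set
InP (x , y , z) = ((+ 0 < x) × (x ≤ y) × (y < z)) ⊎ ((x , y , z) ≡ (+ 1 , + 1 , + 1))

-- Write v = (a , b , c). If a + b < c, the first two entries of v A₀⁻¹ = (c - b , a , b)
-- are in decreasing order, which no element of P allows. Otherwise b < c - a fails, so
-- v A₁⁻¹ = (a , b , c - a) can only lie in P as (1 , 1 , 1), forcing v = (1 , 1 , 2).
module Submission where

open import Defs
open import Data.Integer using (+_; _-_; _+_; _≤_; _<?_)
open import Data.Integer.Properties using (≤-refl; <⇒≱; i≤j⇒i-j≤0; i-j≤0⇒i≤j)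
open import Data.Integer.Tactic.RingSolver using (solve-∀)
open import Data.Product using (_,_)
open import Data.Product.Properties using (,-injectiveˡ; ,-injectiveʳ)
open import Data.Sum using (_⊎_; inj₁; inj₂)
open import Relation.Nullary using (¬_; yes; no)
open import Relation.Binary.PropositionalEquality using (_≡_; refl; cong; subst; module ≡-Reasoning)

InP⇒≤ : ∀ {x y z} → InP (x , y , z) → x ≤ y
InP⇒≤ (inj₁ (_ , x≤y , _)) = x≤y
InP⇒≤ (inj₂ refl)          = ≤-refl

i-j≤k⇒i-k≤j : ∀ i j k → i - j ≤ k → i - k ≤ j
i-j≤k⇒i-k≤j i j k i-j≤k = i-j≤0⇒i≤j (subst (_≤ + 0) (swap i j k) (i≤j⇒i-j≤0 i-j≤k))
  where
  swap : ∀ i j k → i - j - k ≡ i - k - j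
  swap = solve-∀

i-1≡1⇒i≡2 : ∀ {i} → i - + 1 ≡ + 1 → i ≡ + 2
i-1≡1⇒i≡2 {i} i-1≡1 = begin
  i             ≡⟨ undo-1 i ⟩
  i - + 1 + + 1 ≡⟨ cong (_+ + 1) i-1≡1 ⟩
  + 2           ∎
  where
  open ≡-Reasoning
  undo-1 : ∀ i → i ≡ i - + 1 + + 1
  undo-1 = solve-∀

actA₁⁻¹≡111⇒≡112 : ∀ {a b c} → actA₁⁻¹ (a , b , c) ≡ (+ 1 , + 1 , + 1) →
                   (a , b , c) ≡ (+ 1 , + 1 , + 2)
actA₁⁻¹≡111⇒≡112 e with ,-injectiveˡ e | ,-injectiveˡ (,-injectiveʳ e)
... | refl | refl = cong (λ c → + 1 , + 1 , c) (i-1≡1⇒i≡2 (,-injectiveʳ (,-injectiveʳ e)))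

proposition30 : (v : Triple) → InP v → ¬ (v ≡ (+ 1 , + 1 , + 2)) →
    ¬ InP (actA₀⁻¹ v) ⊎ ¬ InP (actA₁⁻¹ v)
proposition30 (a , b , c) _ v≢112 with b <? c - a
... | yes b<c-a = inj₁ λ v′∈P → <⇒≱ b<c-a (i-j≤k⇒i-k≤j c b a (InP⇒≤ v′∈P))
... | no  b≮c-a = inj₂ λ where
  (inj₁ (_ , _ , b<c-a)) → b≮c-a b<c-a
  (inj₂ v′≡111)          → v≢112 (actA₁⁻¹≡111⇒≡112 v′≡111)
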